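{- Let $H_1=(V_1,E_1)$ and $H_2=(V_2,E_2)$ be finite metric $3$-uniform hypergraphs with $V_1\cap V_2=\emptyset$. Then the hypergraph $H=(V_1\cup V_2,\,E_1\cup E_2)$ is metric.
   Context: Given a metric space $M=(X,\rho)$ and three distinct points $x,y,z\in X$, $y$ is said to be between $x$ and $z$ if $\rho(x,z)=\rho(x,y)+\rho(y,z)$; the triple $\{x,y,z\}$ is collinear if one of its points is between the other two. The hypergraph $H_M$ associated with $M$ is the $3$-uniform hypergraph whose vertices are the points of $M$ and whose hyperedges are exactly the collinear triples of $M$. A $3$-uniform hypergraph $H$ is metric if there is a metric space $M$ with $H_M=H$.
   Formalization: The metric spaces realising $H_1$, $H_2$ and $H$ in the definition of a metric hypergraph take rational distances. -}

module Defs where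

open import Data.Nat using (ℕ)
open import Data.Fin using (Fin)
open import Data.Rational using (ℚ; 0ℚ; _+_; _≤_)
open import Data.Sum using (_⊎_; inj₁; inj₂)
open import Data.Product using (_×_; Σ; ∃)
open import Data.Empty using (⊥)
open import Relation.Nullary using (¬_)
open import Relation.Binary.PropositionalEquality using (_≡_)
open import Function.Bundles using (_⇔_)

-- A 3-uniform hypergraph on a vertex type V is given by its hyperedge predicate
-- on (ordered) triples; E x y z means that {x,y,z} is a hyperedge.
Edges : Set → Set₁
Edges V = V → V → V → Set

record IsMetric {V : Set} (ρ : V → V → ℚ) : Set where
  field
    zero⇔eq  : ∀ x y → (ρ x y ≡ 0ℚ) ⇔ (x ≡ y)
    sym      : ∀ x y → ρ x y ≡ ρ y x
    triangle : ∀ x y z → ρ x z ≤ ρ x y + ρ y z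

Between : {V : Set} → (V → V → ℚ) → V → V → V → Set
Between ρ x y z = ρ x z ≡ ρ x y + ρ y z

Distinct3 : {V : Set} → V → V → V → Set
Distinct3 x y z = ¬ (x ≡ y) × ¬ (y ≡ z) × ¬ (x ≡ z)

Collinear : {V : Set} → (V → V → ℚ) → V → V → V → Set
Collinear ρ x y z =
  Distinct3 x y z × (Between ρ y x z ⊎ Between ρ x y z ⊎ Between ρ x z y)

IsMetricHypergraph : {V : Set} → Edges V → Set
IsMetricHypergraph {V} E =
  Σ (V → V → ℚ) λ ρ → IsMetric ρ × (∀ x y z → E x y z ⇔ Collinear ρ x y z)

UnionEdges : {V₁ V₂ : Set} → Edges V₁ → Edges V₂ → Edges (V₁ ⊎ V₂)
UnionEdges E₁ E₂ (inj₁ x) (inj₁ y) (inj₁ z) = E₁ x y z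
UnionEdges E₁ E₂ (inj₂ x) (inj₂ y) (inj₂ z) = E₂ x y z
UnionEdges E₁ E₂ _ _ _ = ⊥

{-# OPTIONS --safe #-}
module Submission where

-- Keep each metric on its own side and put every pair of points from different
-- sides at one common distance D, with D > 0 and D at least every distance inside
-- either side (finite metric spaces are bounded). The triangle inequality then
-- holds, same-side triples keep their collinearity, and a mixed triple is never
-- collinear: a crossing point would need two same-side points at distance 2D > D,
-- and a same-side pair x, y lying on the way to the other side would need
-- ρ x y = 0.

open import Defs
open import Data.Nat using (ℕ; zero; suc)
open import Data.Fin using (Fin; zero; suc)
open import Data.Rational using (ℚ; 0ℚ; 1ℚ; _+_; _≤_; _<_; _⊔_)
open import Data.Rational.Properties
open import Algebra.Properties.Group +-0-group using (identityˡ-unique; identityʳ-unique)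
open import Data.Sum using (_⊎_; inj₁; inj₂)
open import Data.Sum.Properties using (inj₁-injective; inj₂-injective)
open import Data.Product using (Σ; _,_; proj₁; proj₂; map₁)
open import Data.Empty using (⊥; ⊥-elim)
open import Data.Unit using (⊤)
open import Function using (_∘_)
open import Function.Definitions using (Injective)
open import Function.Bundles using (_⇔_; mk⇔; Equivalence)
open import Function.Construct.Composition using (_⇔-∘_)
open import Relation.Nullary using (¬_)
open import Relation.Binary.PropositionalEquality using (_≡_; refl; sym; cong)

p≤q+p : ∀ {p q} → 0ℚ ≤ q → p ≤ q + p
p≤q+p {p} {q} 0≤q = ≤-trans (≤-reflexive (sym (+-identityˡ p))) (+-monoˡ-≤ p 0≤q)

p≤p+q : ∀ {p q} → 0ℚ ≤ q → p ≤ p + q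
p≤p+q {p} {q} 0≤q = ≤-trans (≤-reflexive (sym (+-identityʳ p))) (+-monoʳ-≤ p 0≤q)

p≤q⇒p<q+q : ∀ {p q} → 0ℚ < q → p ≤ q → p < q + q
p≤q⇒p<q+q {p} {q} 0<q p≤q = begin-strict
  p        ≤⟨ p≤q ⟩
  q        ≡⟨ sym (+-identityʳ q) ⟩
  q + 0ℚ   <⟨ +-monoʳ-< q 0<q ⟩
  q + q    ∎
  where open ≤-Reasoning

module MetricProperties {V : Set} {ρ : V → V → ℚ} (m : IsMetric ρ) where
  open IsMetric m using (zero⇔eq; triangle)

  ρ≡0⇒≡ : ∀ {x y} → ρ x y ≡ 0ℚ → x ≡ y
  ρ≡0⇒≡ = Equivalence.to (zero⇔eq _ _)

  ρ-refl : ∀ x → ρ x x ≡ 0ℚ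
  ρ-refl x = Equivalence.from (zero⇔eq x x) refl

  ρ-nonneg : ∀ x y → 0ℚ ≤ ρ x y
  ρ-nonneg x y = ≮⇒≥ (λ ρ<0 → <-irrefl refl (≤-<-trans 0≤ρ+ρ (+-mono-< {ρ x y} {0ℚ} ρ<0 ρ<0)))
    where
    open ≤-Reasoning
    0≤ρ+ρ : 0ℚ ≤ ρ x y + ρ x y
    0≤ρ+ρ = begin
      0ℚ              ≡⟨ sym (ρ-refl x) ⟩
      ρ x x           ≤⟨ triangle x y x ⟩
      ρ x y + ρ y x   ≡⟨ cong (ρ x y +_) (sym (IsMetric.sym m x y)) ⟩
      ρ x y + ρ x y   ∎

Bounded : {V : Set} → (V → V → ℚ) → Set
Bounded {V} ρ = Σ ℚ λ M → ∀ x y → ρ x y ≤ M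

Fin-boundedAbove : ∀ {n} (f : Fin n → ℚ) → Σ ℚ λ M → ∀ i → f i ≤ M
Fin-boundedAbove {zero}  f = 0ℚ , λ ()
Fin-boundedAbove {suc n} f with Fin-boundedAbove (f ∘ suc)
... | M , f∘suc≤M = f zero ⊔ M , λ where
  zero    → p≤p⊔q (f zero) M
  (suc i) → p≤q⇒p≤r⊔q (f zero) (f∘suc≤M i)

Fin-bounded : ∀ {n} (ρ : Fin n → Fin n → ℚ) → Bounded ρ
Fin-bounded ρ with Fin-boundedAbove (λ x → proj₁ (Fin-boundedAbove (ρ x)))
... | M , rows≤M = M , λ x y → ≤-trans (proj₂ (Fin-boundedAbove (ρ x)) y) (rows≤M x)

module _ {A B : Set} {f : A → B} where

  distinct3-injective : Injective _≡_ _≡_ f → ∀ {x y z} →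
                        Distinct3 x y z → Distinct3 (f x) (f y) (f z)
  distinct3-injective f-inj (x≢y , y≢z , x≢z) = x≢y ∘ f-inj , y≢z ∘ f-inj , x≢z ∘ f-inj

  distinct3-reflect : ∀ {x y z} → Distinct3 (f x) (f y) (f z) → Distinct3 x y z
  distinct3-reflect (fx≢fy , fy≢fz , fx≢fz) = fx≢fy ∘ cong f , fy≢fz ∘ cong f , fx≢fz ∘ cong f

  collinear-injective : (σ : B → B → ℚ) → Injective _≡_ _≡_ f → ∀ x y z →
                        Collinear (λ a b → σ (f a) (f b)) x y z ⇔ Collinear σ (f x) (f y) (f z)
  collinear-injective σ f-inj x y z =
    mk⇔ (map₁ (distinct3-injective f-inj)) (map₁ distinct3-reflect)

glue : {V₁ V₂ : Set} → ℚ → (V₁ → V₁ → ℚ) → (V₂ → V₂ → ℚ) → V₁ ⊎ V₂ → V₁ ⊎ V₂ → ℚ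
glue D ρ₁ ρ₂ (inj₁ x) (inj₁ y) = ρ₁ x y
glue D ρ₁ ρ₂ (inj₂ x) (inj₂ y) = ρ₂ x y
glue D ρ₁ ρ₂ _        _        = D

Mixed : {V₁ V₂ : Set} → V₁ ⊎ V₂ → V₁ ⊎ V₂ → V₁ ⊎ V₂ → Set
Mixed (inj₁ _) (inj₁ _) (inj₁ _) = ⊥
Mixed (inj₂ _) (inj₂ _) (inj₂ _) = ⊥
Mixed _        _        _        = ⊤

module Glue {V₁ V₂ : Set} {ρ₁ : V₁ → V₁ → ℚ} {ρ₂ : V₂ → V₂ → ℚ}
            (m₁ : IsMetric ρ₁) (m₂ : IsMetric ρ₂) {D : ℚ} (0<D : 0ℚ < D)
            (ρ₁≤D : ∀ x y → ρ₁ x y ≤ D) (ρ₂≤D : ∀ x y → ρ₂ x y ≤ D) where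

  private
    ρ : V₁ ⊎ V₂ → V₁ ⊎ V₂ → ℚ
    ρ = glue D ρ₁ ρ₂
    module M₁ = MetricProperties m₁
    module M₂ = MetricProperties m₂

  isMetric : IsMetric ρ
  isMetric = record { zero⇔eq = zero⇔eq ; sym = symmetric ; triangle = triangle }
    where
    D≢0 : ¬ D ≡ 0ℚ
    D≢0 D≡0 = <-irrefl (sym D≡0) 0<D

    zero⇔eq : ∀ x y → (ρ x y ≡ 0ℚ) ⇔ (x ≡ y)
    zero⇔eq (inj₁ x) (inj₁ y) = mk⇔ (cong inj₁ ∘ M₁.ρ≡0⇒≡) (λ { refl → M₁.ρ-refl x })
    zero⇔eq (inj₂ x) (inj₂ y) = mk⇔ (cong inj₂ ∘ M₂.ρ≡0⇒≡) (λ { refl → M₂.ρ-refl x })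
    zero⇔eq (inj₁ x) (inj₂ y) = mk⇔ (⊥-elim ∘ D≢0) (λ ())
    zero⇔eq (inj₂ x) (inj₁ y) = mk⇔ (⊥-elim ∘ D≢0) (λ ())

    symmetric : ∀ x y → ρ x y ≡ ρ y x
    symmetric (inj₁ x) (inj₁ y) = IsMetric.sym m₁ x y
    symmetric (inj₂ x) (inj₂ y) = IsMetric.sym m₂ x y
    symmetric (inj₁ x) (inj₂ y) = refl
    symmetric (inj₂ x) (inj₁ y) = refl

    triangle : ∀ x y z → ρ x z ≤ ρ x y + ρ y z
    triangle (inj₁ x) (inj₁ y) (inj₁ z) = IsMetric.triangle m₁ x y z
    triangle (inj₂ x) (inj₂ y) (inj₂ z) = IsMetric.triangle m₂ x y z
    triangle (inj₁ x) (inj₁ y) (inj₂ z) = p≤q+p (M₁.ρ-nonneg x y)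
    triangle (inj₂ x) (inj₂ y) (inj₁ z) = p≤q+p (M₂.ρ-nonneg x y)
    triangle (inj₁ x) (inj₂ y) (inj₂ z) = p≤p+q (M₂.ρ-nonneg y z)
    triangle (inj₂ x) (inj₁ y) (inj₁ z) = p≤p+q (M₁.ρ-nonneg y z)
    triangle (inj₁ x) (inj₂ y) (inj₁ z) = <⇒≤ (p≤q⇒p<q+q 0<D (ρ₁≤D x z))
    triangle (inj₂ x) (inj₁ y) (inj₂ z) = <⇒≤ (p≤q⇒p<q+q 0<D (ρ₂≤D x z))

  ¬between-mixed : ∀ p q r → ¬ p ≡ q → ¬ q ≡ r → Mixed p q r → ¬ Between ρ p q r
  ¬between-mixed (inj₁ p) (inj₁ q) (inj₂ r) p≢q _ _ b =
    p≢q (cong inj₁ (M₁.ρ≡0⇒≡ (identityˡ-unique _ D (sym b))))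
  ¬between-mixed (inj₂ p) (inj₂ q) (inj₁ r) p≢q _ _ b =
    p≢q (cong inj₂ (M₂.ρ≡0⇒≡ (identityˡ-unique _ D (sym b))))
  ¬between-mixed (inj₂ p) (inj₁ q) (inj₁ r) _ q≢r _ b =
    q≢r (cong inj₁ (M₁.ρ≡0⇒≡ (identityʳ-unique D _ (sym b))))
  ¬between-mixed (inj₁ p) (inj₂ q) (inj₂ r) _ q≢r _ b =
    q≢r (cong inj₂ (M₂.ρ≡0⇒≡ (identityʳ-unique D _ (sym b))))
  ¬between-mixed (inj₁ p) (inj₂ q) (inj₁ r) _ _ _ b = <-irrefl b (p≤q⇒p<q+q 0<D (ρ₁≤D p r))
  ¬between-mixed (inj₂ p) (inj₁ q) (inj₂ r) _ _ _ b = <-irrefl b (p≤q⇒p<q+q 0<D (ρ₂≤D p r))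

  -- Mixed is invariant under permuting its arguments, but Agda only sees this once
  -- the sides are known, so each betweenness case gets its own hypothesis.
  ¬collinear-mixed : ∀ {p q r} → Mixed q p r → Mixed p q r → Mixed p r q →
                     ¬ Collinear ρ p q r
  ¬collinear-mixed {p} {q} {r} qpr pqr prq ((p≢q , q≢r , p≢r) , between) with between
  ... | inj₁ q-p-r        = ¬between-mixed q p r (p≢q ∘ sym) p≢r qpr q-p-r
  ... | inj₂ (inj₁ p-q-r) = ¬between-mixed p q r p≢q q≢r pqr p-q-r
  ... | inj₂ (inj₂ p-r-q) = ¬between-mixed p r q p≢r (q≢r ∘ sym) prq p-r-q

  unionEdges⇔collinear : {E₁ : Edges V₁} {E₂ : Edges V₂} →
                         (∀ x y z → E₁ x y z ⇔ Collinear ρ₁ x y z) →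
                         (∀ x y z → E₂ x y z ⇔ Collinear ρ₂ x y z) →
                         ∀ p q r → UnionEdges E₁ E₂ p q r ⇔ Collinear ρ p q r
  unionEdges⇔collinear {E₁} {E₂} E₁⇔ E₂⇔ = go
    where
    mixed : ∀ {p q r} → ¬ UnionEdges E₁ E₂ p q r → Mixed q p r → Mixed p q r → Mixed p r q →
            UnionEdges E₁ E₂ p q r ⇔ Collinear ρ p q r
    mixed ¬edge qpr pqr prq = mk⇔ (⊥-elim ∘ ¬edge) (⊥-elim ∘ ¬collinear-mixed qpr pqr prq)

    go : ∀ p q r → UnionEdges E₁ E₂ p q r ⇔ Collinear ρ p q r
    go (inj₁ x) (inj₁ y) (inj₁ z) = collinear-injective ρ inj₁-injective x y z ⇔-∘ E₁⇔ x y z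
    go (inj₂ x) (inj₂ y) (inj₂ z) = collinear-injective ρ inj₂-injective x y z ⇔-∘ E₂⇔ x y z
    go (inj₁ x) (inj₁ y) (inj₂ z) = mixed (λ ()) _ _ _
    go (inj₁ x) (inj₂ y) (inj₁ z) = mixed (λ ()) _ _ _
    go (inj₁ x) (inj₂ y) (inj₂ z) = mixed (λ ()) _ _ _
    go (inj₂ x) (inj₁ y) (inj₁ z) = mixed (λ ()) _ _ _
    go (inj₂ x) (inj₁ y) (inj₂ z) = mixed (λ ()) _ _ _
    go (inj₂ x) (inj₂ y) (inj₁ z) = mixed (λ ()) _ _ _

union-isMetricHypergraph : {V₁ V₂ : Set} {E₁ : Edges V₁} {E₂ : Edges V₂} →
                           (H₁ : IsMetricHypergraph E₁) (H₂ : IsMetricHypergraph E₂) →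
                           Bounded (proj₁ H₁) → Bounded (proj₁ H₂) →
                           IsMetricHypergraph (UnionEdges E₁ E₂)
union-isMetricHypergraph (ρ₁ , m₁ , E₁⇔) (ρ₂ , m₂ , E₂⇔) (M₁ , ρ₁≤M₁) (M₂ , ρ₂≤M₂) =
  glue D ρ₁ ρ₂ , isMetric , unionEdges⇔collinear E₁⇔ E₂⇔
  where
  D : ℚ
  D = 1ℚ ⊔ (M₁ ⊔ M₂)

  0<D : 0ℚ < D
  0<D = <-≤-trans (positive⁻¹ 1ℚ) (p≤p⊔q 1ℚ (M₁ ⊔ M₂))

  ρ₁≤D : ∀ x y → ρ₁ x y ≤ D
  ρ₁≤D x y = ≤-trans (ρ₁≤M₁ x y) (≤-trans (p≤p⊔q M₁ M₂) (p≤q⊔p 1ℚ _))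

  ρ₂≤D : ∀ x y → ρ₂ x y ≤ D
  ρ₂≤D x y = ≤-trans (ρ₂≤M₂ x y) (≤-trans (p≤q⊔p M₁ M₂) (p≤q⊔p 1ℚ _))

  open Glue m₁ m₂ 0<D ρ₁≤D ρ₂≤D

lemma1 : (n₁ n₂ : ℕ) (E₁ : Edges (Fin n₁)) (E₂ : Edges (Fin n₂)) →
    IsMetricHypergraph E₁ → IsMetricHypergraph E₂ →
    IsMetricHypergraph (UnionEdges E₁ E₂)
lemma1 _ _ _ _ H₁ H₂ =
  union-isMetricHypergraph H₁ H₂ (Fin-bounded (proj₁ H₁)) (Fin-bounded (proj₁ H₂))
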